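{- For integers $n,k,r\ge 0$ with $n\ge k$, \[ U(n,k)=\sum_{i=k}^{n}\binom{n}{i}(-r)^{n-i}\,U_r(i,k). \]
   Context: For a nonnegative integer $r$, the numbers $U_r(n,k)$ ($n,k\ge 0$ integers) are defined by $U_r(n,k)=U_r(n-1,k-1)+(k^2+r)\,U_r(n-1,k)$ for $n\ge k\ge 1$, with $U_r(n,0)=r^n$ (with $0^0=1$), $U_r(0,k)=\delta_{k0}$, and $U_r(n,k)=0$ for $k>n$. The central factorial numbers with even indices of the second kind are $U(n,k):=U_0(n,k)$ (equivalently $U(n,k)=T(2n,2k)$ where $T$ are the central factorial numbers of the second kind). -}

module Defs where

open import Data.Nat using (ℕ; zero; suc; _+_; _*_; _^_; _∸_)
open import Data.Integer as ℤ using (ℤ; +_)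

-- U_r(0,k) = δ_{k0};  U_r(n,0) = r^n;
--   U_r(n,k) = U_r(n-1,k-1) + (k^2 + r) U_r(n-1,k)  for n ≥ 1, k ≥ 1.
-- (For k > n this recursion yields 0, matching the paper's convention.)
U : ℕ → ℕ → ℕ → ℕ
U r zero    zero    = 1
U r zero    (suc k) = 0
U r (suc n) zero    = r ^ suc n
U r (suc n) (suc k) = U r n k + (suc k * suc k + r) * U r n (suc k)

-- Central factorial numbers with even indices of the second kind: U(n,k) = U_0(n,k).
U₀ : ℕ → ℕ → ℕ
U₀ = U 0

sumFrom : ℕ → ℕ → (ℕ → ℤ) → ℤ
sumFrom a zero    f = + 0
sumFrom a (suc m) f = f a ℤ.+ sumFrom (suc a) m f

sumRange : ℕ → ℕ → (ℕ → ℤ) → ℤ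
sumRange a b f = sumFrom a (suc b ∸ a) f

-- For s ∈ ℤ let T_s a n = Σᵢ C(n,i) sⁿ⁻ⁱ aᵢ be the binomial transform of a sequence a.
-- Pascal's rule gives T_s a (n+1) = s · T_s a n + T_s (a ∘ suc) n, so T_s can be taken
-- to be defined by this recursion, and it is then visibly linear in a. The recurrence of
-- U_r in n, read at fixed k, says that (i ↦ U_r(i+1,k+1)) = U_r(·,k) + (k²+r) U_r(·,k+1);
-- applying T_{-r} the two occurrences of r cancel and one obtains exactly the recurrence
-- of U = U₀, which proves U₀(·,k) = T_{-r} U_r(·,k) by induction on n.
module Submission where

open import Defs
open import Data.Nat using (ℕ; _≤_; _∸_)
open import Data.Nat.Combinatorics using (_C_)
open import Data.Integer as ℤ using (ℤ; +_; -_)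
open import Relation.Binary.PropositionalEquality using (_≡_)

open import Data.Nat as ℕ using (zero; suc; _<_; s≤s; z≤n)
import Data.Nat.Properties as ℕP
open import Data.Nat.Combinatorics using (nCk+nC[k+1]≡[n+1]C[k+1]; k>n⇒nCk≡0)
import Data.Integer.Properties as ℤP
open import Data.Integer.Tactic.RingSolver using (solve-∀)
open import Relation.Nullary using (yes; no)
open import Relation.Binary.PropositionalEquality using (refl; sym; trans; cong; cong₂; module ≡-Reasoning)
open ≡-Reasoning

sumFrom-cong : ∀ a m {f g : ℕ → ℤ} → (∀ i → f i ≡ g i) → sumFrom a m f ≡ sumFrom a m g
sumFrom-cong a zero    f≗g = refl
sumFrom-cong a (suc m) f≗g = cong₂ ℤ._+_ (f≗g a) (sumFrom-cong (suc a) m f≗g)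

sumFrom-suc : ∀ a m (f : ℕ → ℤ) → sumFrom (suc a) m f ≡ sumFrom a m (λ i → f (suc i))
sumFrom-suc a zero    f = refl
sumFrom-suc a (suc m) f = cong (ℤ._+_ (f (suc a))) (sumFrom-suc (suc a) m f)

sumFrom-+ : ∀ a m (f g : ℕ → ℤ) →
            sumFrom a m (λ i → f i ℤ.+ g i) ≡ sumFrom a m f ℤ.+ sumFrom a m g
sumFrom-+ a zero    f g = refl
sumFrom-+ a (suc m) f g = trans (cong (ℤ._+_ (f a ℤ.+ g a)) (sumFrom-+ (suc a) m f g))
                                (interchange (f a) (g a) (sumFrom (suc a) m f) (sumFrom (suc a) m g))
  where
  interchange : ∀ x y z w → (x ℤ.+ y) ℤ.+ (z ℤ.+ w) ≡ (x ℤ.+ z) ℤ.+ (y ℤ.+ w)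
  interchange = solve-∀

sumFrom-*ˡ : ∀ a m c (f : ℕ → ℤ) → sumFrom a m (λ i → c ℤ.* f i) ≡ c ℤ.* sumFrom a m f
sumFrom-*ˡ a zero    c f = sym (ℤP.*-zeroʳ c)
sumFrom-*ˡ a (suc m) c f = trans (cong (ℤ._+_ (c ℤ.* f a)) (sumFrom-*ˡ (suc a) m c f))
                                 (sym (ℤP.*-distribˡ-+ c (f a) (sumFrom (suc a) m f)))

sumFrom-zeros : ∀ a m {f : ℕ → ℤ} → (∀ i → f i ≡ + 0) → sumFrom a m f ≡ + 0
sumFrom-zeros a zero    f≗0 = refl
sumFrom-zeros a (suc m) f≗0 = cong₂ ℤ._+_ (f≗0 a) (sumFrom-zeros (suc a) m f≗0)

sumFrom-dropLeadingZeros : ∀ j m (f : ℕ → ℤ) → (∀ i → i < j → f i ≡ + 0) →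
                           sumFrom 0 (j ℕ.+ m) f ≡ sumFrom j m f
sumFrom-dropLeadingZeros zero    m f f<j≡0 = refl
sumFrom-dropLeadingZeros (suc j) m f f<j≡0 = begin
  f 0 ℤ.+ sumFrom 1 (j ℕ.+ m) f                 ≡⟨ cong₂ ℤ._+_ (f<j≡0 0 (s≤s z≤n)) (sumFrom-suc 0 (j ℕ.+ m) f) ⟩
  + 0 ℤ.+ sumFrom 0 (j ℕ.+ m) (λ i → f (suc i)) ≡⟨ ℤP.+-identityˡ _ ⟩
  sumFrom 0 (j ℕ.+ m) (λ i → f (suc i))         ≡⟨ sumFrom-dropLeadingZeros j m _ (λ i i<j → f<j≡0 (suc i) (s≤s i<j)) ⟩
  sumFrom j m (λ i → f (suc i))                 ≡⟨ sumFrom-suc j m f ⟨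
  sumFrom (suc j) m f                           ∎

module _ (s : ℤ) where

  binomialTransform : (ℕ → ℤ) → ℕ → ℤ
  binomialTransform a zero    = a 0
  binomialTransform a (suc n) = s ℤ.* binomialTransform a n ℤ.+ binomialTransform (λ i → a (suc i)) n

  binomialTransform-cong : ∀ n {a b : ℕ → ℤ} → (∀ i → a i ≡ b i) →
                           binomialTransform a n ≡ binomialTransform b n
  binomialTransform-cong zero    a≗b = a≗b 0
  binomialTransform-cong (suc n) a≗b =
    cong₂ (λ x y → s ℤ.* x ℤ.+ y) (binomialTransform-cong n a≗b) (binomialTransform-cong n (λ i → a≗b (suc i)))

  binomialTransform-+ : ∀ n (a b : ℕ → ℤ) →
    binomialTransform (λ i → a i ℤ.+ b i) n ≡ binomialTransform a n ℤ.+ binomialTransform b n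
  binomialTransform-+ zero    a b = refl
  binomialTransform-+ (suc n) a b =
    trans (cong₂ (λ x y → s ℤ.* x ℤ.+ y) (binomialTransform-+ n a b) (binomialTransform-+ n _ _))
          (regroup s _ _ _ _)
    where
    regroup : ∀ s x y z w → s ℤ.* (x ℤ.+ y) ℤ.+ (z ℤ.+ w) ≡ (s ℤ.* x ℤ.+ z) ℤ.+ (s ℤ.* y ℤ.+ w)
    regroup = solve-∀

  binomialTransform-*ˡ : ∀ n c (a : ℕ → ℤ) →
    binomialTransform (λ i → c ℤ.* a i) n ≡ c ℤ.* binomialTransform a n
  binomialTransform-*ˡ zero    c a = refl
  binomialTransform-*ˡ (suc n) c a =
    trans (cong₂ (λ x y → s ℤ.* x ℤ.+ y) (binomialTransform-*ˡ n c a) (binomialTransform-*ˡ n c _))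
          (regroup s c _ _)
    where
    regroup : ∀ s c x y → s ℤ.* (c ℤ.* x) ℤ.+ c ℤ.* y ≡ c ℤ.* (s ℤ.* x ℤ.+ y)
    regroup = solve-∀

  binomialTerm : ℕ → (ℕ → ℤ) → ℕ → ℤ
  binomialTerm n a i = + (n C i) ℤ.* s ℤ.^ (n ∸ i) ℤ.* a i

  ^-∸-suc : ∀ n i → i < n → s ℤ.^ (n ∸ i) ≡ s ℤ.* s ℤ.^ (n ∸ suc i)
  ^-∸-suc (suc n) zero    _       = refl
  ^-∸-suc (suc n) (suc i) (s≤s i<n) = ^-∸-suc n i i<n

  -- For i ≥ n the binomial coefficient vanishes, so the truncated exponent n ∸ suc i is harmless.
  binomialTerm-factor : ∀ n i (a : ℕ → ℤ) →
    + (n C suc i) ℤ.* s ℤ.^ (n ∸ i) ℤ.* a (suc i) ≡ s ℤ.* binomialTerm n a (suc i)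
  binomialTerm-factor n i a with i ℕP.<? n
  ... | yes i<n rewrite ^-∸-suc n i i<n = reassoc (+ (n C suc i)) s _ (a (suc i))
    where
    reassoc : ∀ c s p x → c ℤ.* (s ℤ.* p) ℤ.* x ≡ s ℤ.* (c ℤ.* p ℤ.* x)
    reassoc = solve-∀
  ... | no i≮n rewrite k>n⇒nCk≡0 (s≤s (ℕP.≮⇒≥ i≮n)) = sym (ℤP.*-zeroʳ s)

  binomialTerm-pascal : ∀ n i (a : ℕ → ℤ) →
    binomialTerm (suc n) a (suc i) ≡ binomialTerm n (λ j → a (suc j)) i ℤ.+ s ℤ.* binomialTerm n a (suc i)
  binomialTerm-pascal n i a = begin
    + (suc n C suc i) ℤ.* p ℤ.* x                       ≡⟨ cong (λ c → + c ℤ.* p ℤ.* x) (nCk+nC[k+1]≡[n+1]C[k+1] n i) ⟨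
    + (n C i ℕ.+ n C suc i) ℤ.* p ℤ.* x                 ≡⟨ cong (λ c → c ℤ.* p ℤ.* x) (ℤP.pos-+ (n C i) (n C suc i)) ⟩
    (+ (n C i) ℤ.+ + (n C suc i)) ℤ.* p ℤ.* x           ≡⟨ distrib (+ (n C i)) (+ (n C suc i)) p x ⟩
    + (n C i) ℤ.* p ℤ.* x ℤ.+ + (n C suc i) ℤ.* p ℤ.* x ≡⟨ cong (ℤ._+_ (binomialTerm n (λ j → a (suc j)) i)) (binomialTerm-factor n i a) ⟩
    binomialTerm n (λ j → a (suc j)) i ℤ.+ s ℤ.* binomialTerm n a (suc i) ∎
    where
    p = s ℤ.^ (n ∸ i)
    x = a (suc i)
    distrib : ∀ c d p x → (c ℤ.+ d) ℤ.* p ℤ.* x ≡ c ℤ.* p ℤ.* x ℤ.+ d ℤ.* p ℤ.* x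
    distrib = solve-∀

  binomialTransform-closedForm : ∀ n m (a : ℕ → ℤ) → n < m →
    binomialTransform a n ≡ sumFrom 0 m (binomialTerm n a)
  binomialTransform-closedForm zero (suc m) a _ = sym (begin
    + 1 ℤ.* + 1 ℤ.* a 0 ℤ.+ sumFrom 1 m (binomialTerm 0 a) ≡⟨ cong₂ ℤ._+_ (ℤP.*-identityˡ (a 0)) (sumFrom-suc 0 m _) ⟩
    a 0 ℤ.+ sumFrom 0 m (λ i → binomialTerm 0 a (suc i))   ≡⟨ cong (ℤ._+_ (a 0)) (sumFrom-zeros 0 m vanish) ⟩
    a 0 ℤ.+ + 0                                            ≡⟨ ℤP.+-identityʳ (a 0) ⟩
    a 0                                                   ∎)
    where
    vanish : ∀ i → binomialTerm 0 a (suc i) ≡ + 0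
    vanish i = ℤP.*-zeroˡ (a (suc i))
  binomialTransform-closedForm (suc n) (suc m) a (s≤s n<m) = sym (begin
    sumFrom 0 (suc m) (binomialTerm (suc n) a)
      ≡⟨ cong (ℤ._+_ (binomialTerm (suc n) a 0)) (sumFrom-suc 0 m _) ⟩
    binomialTerm (suc n) a 0 ℤ.+ sumFrom 0 m (λ i → binomialTerm (suc n) a (suc i))
      ≡⟨ cong (ℤ._+_ (binomialTerm (suc n) a 0)) (sumFrom-cong 0 m (λ i → binomialTerm-pascal n i a)) ⟩
    binomialTerm (suc n) a 0 ℤ.+ sumFrom 0 m (λ i → X i ℤ.+ s ℤ.* Y i)
      ≡⟨ cong (ℤ._+_ (binomialTerm (suc n) a 0)) (trans (sumFrom-+ 0 m X _) (cong (ℤ._+_ (sumFrom 0 m X)) (sumFrom-*ˡ 0 m s Y))) ⟩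
    + 1 ℤ.* (s ℤ.* s ℤ.^ n) ℤ.* a 0 ℤ.+ (sumFrom 0 m X ℤ.+ s ℤ.* sumFrom 0 m Y)
      ≡⟨ regroup s (s ℤ.^ n) (a 0) (sumFrom 0 m X) (sumFrom 0 m Y) ⟩
    s ℤ.* (binomialTerm n a 0 ℤ.+ sumFrom 0 m Y) ℤ.+ sumFrom 0 m X
      ≡⟨ cong (λ t → s ℤ.* (binomialTerm n a 0 ℤ.+ t) ℤ.+ sumFrom 0 m X) (sumFrom-suc 0 m _) ⟨
    s ℤ.* sumFrom 0 (suc m) (binomialTerm n a) ℤ.+ sumFrom 0 m X
      ≡⟨ cong₂ (λ x y → s ℤ.* x ℤ.+ y) (binomialTransform-closedForm n (suc m) a (ℕP.m<n⇒m<1+n n<m))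
                                        (binomialTransform-closedForm n m _ n<m) ⟨
    binomialTransform a (suc n) ∎)
    where
    X Y : ℕ → ℤ
    X = binomialTerm n (λ j → a (suc j))
    Y i = binomialTerm n a (suc i)
    regroup : ∀ s q a₀ x y → + 1 ℤ.* (s ℤ.* q) ℤ.* a₀ ℤ.+ (x ℤ.+ s ℤ.* y) ≡ s ℤ.* (+ 1 ℤ.* q ℤ.* a₀ ℤ.+ y) ℤ.+ x
    regroup = solve-∀

k>n⇒Unk≡0 : ∀ r {n k} → n < k → U r n k ≡ 0
k>n⇒Unk≡0 r {zero}  {suc k} _ = refl
k>n⇒Unk≡0 r {suc n} {suc k} (s≤s n<k)
  rewrite k>n⇒Unk≡0 r n<k | k>n⇒Unk≡0 r (ℕP.m<n⇒m<1+n n<k) = ℕP.*-zeroʳ (suc k ℕ.* suc k ℕ.+ r)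

column : ℕ → ℕ → ℕ → ℤ
column r k i = + U r i k

column-zero-suc : ∀ r i → column r 0 (suc i) ≡ + r ℤ.* column r 0 i
column-zero-suc r zero    = ℤP.pos-* r 1
column-zero-suc r (suc i) = ℤP.pos-* r (r ℕ.^ suc i)

column-suc-suc : ∀ r k i →
  column r (suc k) (suc i) ≡ column r k i ℤ.+ + (suc k ℕ.* suc k ℕ.+ r) ℤ.* column r (suc k) i
column-suc-suc r k i =
  trans (ℤP.pos-+ (U r i k) _) (cong (ℤ._+_ (column r k i)) (ℤP.pos-* (suc k ℕ.* suc k ℕ.+ r) (U r i (suc k))))

binomialTransform-column-suc : ∀ s r n k →
  binomialTransform s (λ i → column r (suc k) (suc i)) n
    ≡ binomialTransform s (column r k) n ℤ.+ + (suc k ℕ.* suc k ℕ.+ r) ℤ.* binomialTransform s (column r (suc k)) n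
binomialTransform-column-suc s r n k = begin
  T (λ i → column r (suc k) (suc i))                    ≡⟨ binomialTransform-cong s n (column-suc-suc r k) ⟩
  T (λ i → column r k i ℤ.+ c ℤ.* column r (suc k) i)   ≡⟨ binomialTransform-+ s n _ _ ⟩
  T (column r k) ℤ.+ T (λ i → c ℤ.* column r (suc k) i) ≡⟨ cong (ℤ._+_ (T (column r k))) (binomialTransform-*ˡ s n c _) ⟩
  T (column r k) ℤ.+ c ℤ.* T (column r (suc k))         ∎
  where
  c = + (suc k ℕ.* suc k ℕ.+ r)
  T : (ℕ → ℤ) → ℤ
  T a = binomialTransform s a n

U₀≡binomialTransform : ∀ r n k → + U₀ n k ≡ binomialTransform (- + r) (column r k) n
U₀≡binomialTransform r zero    zero    = refl
U₀≡binomialTransform r zero    (suc k) = refl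
U₀≡binomialTransform r (suc n) zero    = sym (begin
  - + r ℤ.* T (column r 0) ℤ.+ T (λ i → column r 0 (suc i))
    ≡⟨ cong (ℤ._+_ (- + r ℤ.* T (column r 0))) (binomialTransform-cong (- + r) n (column-zero-suc r)) ⟩
  - + r ℤ.* T (column r 0) ℤ.+ T (λ i → + r ℤ.* column r 0 i)
    ≡⟨ cong (ℤ._+_ (- + r ℤ.* T (column r 0))) (binomialTransform-*ˡ (- + r) n (+ r) _) ⟩
  - + r ℤ.* T (column r 0) ℤ.+ + r ℤ.* T (column r 0)
    ≡⟨ cancel (+ r) (T (column r 0)) ⟩
  + 0 ∎)
  where
  T : (ℕ → ℤ) → ℤ
  T a = binomialTransform (- + r) a n
  cancel : ∀ r x → - r ℤ.* x ℤ.+ r ℤ.* x ≡ + 0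
  cancel = solve-∀
U₀≡binomialTransform r (suc n) (suc k) = begin
  + (U₀ n k ℕ.+ (q ℕ.+ 0) ℕ.* U₀ n (suc k))
    ≡⟨ cong (λ c → + (U₀ n k ℕ.+ c ℕ.* U₀ n (suc k))) (ℕP.+-identityʳ q) ⟩
  + (U₀ n k ℕ.+ q ℕ.* U₀ n (suc k))
    ≡⟨ trans (ℤP.pos-+ (U₀ n k) _) (cong (ℤ._+_ (+ U₀ n k)) (ℤP.pos-* q (U₀ n (suc k)))) ⟩
  + U₀ n k ℤ.+ + q ℤ.* + U₀ n (suc k)
    ≡⟨ cong₂ (λ x y → x ℤ.+ + q ℤ.* y) (U₀≡binomialTransform r n k) (U₀≡binomialTransform r n (suc k)) ⟩
  T (column r k) ℤ.+ + q ℤ.* T (column r (suc k))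
    ≡⟨ regroup (+ q) (+ r) (T (column r k)) (T (column r (suc k))) ⟩
  - + r ℤ.* T (column r (suc k)) ℤ.+ (T (column r k) ℤ.+ (+ q ℤ.+ + r) ℤ.* T (column r (suc k)))
    ≡⟨ cong (ℤ._+_ (- + r ℤ.* T (column r (suc k))))
            (trans (cong (λ c → T (column r k) ℤ.+ c ℤ.* T (column r (suc k))) (sym (ℤP.pos-+ q r)))
                   (sym (binomialTransform-column-suc (- + r) r n k))) ⟩
  - + r ℤ.* T (column r (suc k)) ℤ.+ T (λ i → column r (suc k) (suc i)) ∎
  where
  q = suc k ℕ.* suc k
  T : (ℕ → ℤ) → ℤ
  T a = binomialTransform (- + r) a n
  regroup : ∀ q r y x → y ℤ.+ q ℤ.* x ≡ - r ℤ.* x ℤ.+ (y ℤ.+ (q ℤ.+ r) ℤ.* x)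
  regroup = solve-∀

mainTheorem9 : (n k r : ℕ) → k ≤ n →
    + U₀ n k ≡ sumRange k n (λ i → (+ (n C i)) ℤ.* ((- (+ r)) ℤ.^ (n ∸ i)) ℤ.* (+ U r i k))
mainTheorem9 n k r k≤n = begin
  + U₀ n k                                           ≡⟨ U₀≡binomialTransform r n k ⟩
  binomialTransform (- + r) (column r k) n           ≡⟨ binomialTransform-closedForm (- + r) n (suc n) _ (ℕP.n<1+n n) ⟩
  sumFrom 0 (suc n) term                             ≡⟨ cong (λ m → sumFrom 0 m term) (ℕP.m+[n∸m]≡n (ℕP.m≤n⇒m≤1+n k≤n)) ⟨
  sumFrom 0 (k ℕ.+ (suc n ∸ k)) term                 ≡⟨ sumFrom-dropLeadingZeros k (suc n ∸ k) term i<k⇒term≡0 ⟩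
  sumFrom k (suc n ∸ k) term                         ∎
  where
  term : ℕ → ℤ
  term = binomialTerm (- + r) n (column r k)
  i<k⇒term≡0 : ∀ i → i < k → term i ≡ + 0
  i<k⇒term≡0 i i<k rewrite k>n⇒Unk≡0 r i<k = ℤP.*-zeroʳ (+ (n C i) ℤ.* (- + r) ℤ.^ (n ∸ i))
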